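{- Let $W$ be the Coxeter group of type $B_3$ with generators $s_1,s_2,s_3$, where $m(s_1,s_2)=4$, $m(s_2,s_3)=3$, $m(s_1,s_3)=2$. If $w\in W$ is fully commutative, then every reduced expression for $w$ has at most three occurrences of $s_2$ and at most three occurrences of $s_3$.
   Context: An element is fully commutative if any two of its reduced expressions are related by repeatedly swapping adjacent commuting generators. -}

module Defs where

open import Data.Nat using (ℕ; _≤_)
import Data.Nat as ℕ
open import Data.Fin using (Fin; zero; suc)
open import Data.Fin.Properties using (_≟_)
open import Data.List using (List; []; _∷_; _++_; length; filter)
open import Data.Product using (_×_)
open import Relation.Binary.PropositionalEquality using (_≡_; _≢_)

Gen : Set
Gen = Fin 3

s₁ s₂ s₃ : Gen
s₁ = zero
s₂ = suc zero
s₃ = suc (suc zero)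

m : Gen → Gen → ℕ
m zero zero = 1
m zero (suc zero) = 4
m zero (suc (suc zero)) = 2
m (suc zero) zero = 4
m (suc zero) (suc zero) = 1
m (suc zero) (suc (suc zero)) = 3
m (suc (suc zero)) zero = 2
m (suc (suc zero)) (suc zero) = 3
m (suc (suc zero)) (suc (suc zero)) = 1

Word : Set
Word = List Gen

alt : Gen → Gen → ℕ → Word
alt s t ℕ.zero = []
alt s t (ℕ.suc k) = s ∷ alt t s k

-- Equality in W = ⟨ s₁,s₂,s₃ | s² = 1, (st)^{m(s,t)} = 1 ⟩ on words:
-- the congruence generated by s s = 1 and the braid relations.
data _≈W_ : Word → Word → Set where
  ≈-refl  : ∀ {u} → u ≈W u
  ≈-sym   : ∀ {u v} → u ≈W v → v ≈W u
  ≈-trans : ∀ {u v w} → u ≈W v → v ≈W w → u ≈W w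
  ≈-sq    : ∀ u v s → (u ++ s ∷ s ∷ v) ≈W (u ++ v)
  ≈-braid : ∀ u v s t → s ≢ t →
            (u ++ alt s t (m s t) ++ v) ≈W (u ++ alt t s (m s t) ++ v)

data _~C_ : Word → Word → Set where
  ~-refl  : ∀ {u} → u ~C u
  ~-sym   : ∀ {u v} → u ~C v → v ~C u
  ~-trans : ∀ {u v w} → u ~C v → v ~C w → u ~C w
  ~-swap  : ∀ u v s t → m s t ≡ 2 → (u ++ s ∷ t ∷ v) ~C (u ++ t ∷ s ∷ v)

ReducedExprFor : Word → Word → Set
ReducedExprFor u w = u ≈W w × (∀ v → v ≈W w → length u ≤ length v)

FullyCommutative : Word → Set
FullyCommutative w = ∀ u v → ReducedExprFor u w → ReducedExprFor v w → u ~C v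

occ : Gen → Word → ℕ
occ s u = length (filter (_≟ s) u)

-- A word that can be rearranged by commutations so as to contain a factor s s,
-- or a factor s t s … (m s t letters) with m s t ≠ 2, is not a reduced
-- expression of a fully commutative element: a square can be cancelled, and
-- the braid relation yields an equally short expression which is not
-- commutation equivalent, since erasing s₃ (resp. s₁) is invariant under
-- commutations yet changes the first letter of the braid factor.  Prepending
-- generators one at a time, every word either acquires such a factor or stays
-- commutation equivalent to one of 24 words, one for each fully commutative
-- element of B₃, and these all contain s₂ and s₃ at most three times.
module Submission where

open import Defs
open import Data.Nat using (ℕ; _+_; _≤_; _<_; _≤?_; z<s)
open import Data.Nat.Properties using (+-monoʳ-<; m<n+m; <⇒≱)
open import Data.Product using (_×_; _,_; ∃-syntax; proj₁; proj₂)
open import Data.Sum using (_⊎_; inj₁; inj₂)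
open import Data.Empty using (⊥-elim)
open import Data.Fin using (zero; suc)
open import Data.Fin.Properties using (_≟_)
open import Data.List using ([]; _∷_; _++_; length; filter)
open import Data.List.Properties
  using (length-++; filter-++; filter-accept; filter-reject; ++-cancelˡ; ++-cancelʳ)
open import Data.List.Relation.Binary.Permutation.Propositional
  using (_↭_; swap; ↭-refl; ↭-sym; ↭-trans)
open import Data.List.Relation.Binary.Permutation.Propositional.Properties
  using (↭-length; filter-↭; ++⁺ˡ)
open import Relation.Nullary using (¬_; ¬?; Dec; yes; no)
open import Relation.Nullary.Decidable using (True; toWitness)
open import Relation.Binary.PropositionalEquality
  using (_≡_; _≢_; refl; sym; trans; cong; subst; subst₂; module ≡-Reasoning)

variable
  u v w x : Word
  s t : Gen

m-diagonal : ∀ s → m s s ≡ 1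
m-diagonal zero = refl
m-diagonal (suc zero) = refl
m-diagonal (suc (suc zero)) = refl

commuting-pair : m s t ≡ 2 → (s ≡ s₁ × t ≡ s₃) ⊎ (s ≡ s₃ × t ≡ s₁)
commuting-pair {zero} {suc (suc zero)} _ = inj₁ (refl , refl)
commuting-pair {suc (suc zero)} {zero} _ = inj₂ (refl , refl)
commuting-pair {zero} {zero} ()
commuting-pair {zero} {suc zero} ()
commuting-pair {suc zero} {zero} ()
commuting-pair {suc zero} {suc zero} ()
commuting-pair {suc zero} {suc (suc zero)} ()
commuting-pair {suc (suc zero)} {suc zero} ()
commuting-pair {suc (suc zero)} {suc (suc zero)} ()

~C-∷⁺ : ∀ g → u ~C v → (g ∷ u) ~C (g ∷ v)
~C-∷⁺ g ~-refl = ~-refl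
~C-∷⁺ g (~-sym p) = ~-sym (~C-∷⁺ g p)
~C-∷⁺ g (~-trans p q) = ~-trans (~C-∷⁺ g p) (~C-∷⁺ g q)
~C-∷⁺ g (~-swap u v s t e) = ~-swap (g ∷ u) v s t e

~C⇒↭ : u ~C v → u ↭ v
~C⇒↭ ~-refl = ↭-refl
~C⇒↭ (~-sym p) = ↭-sym (~C⇒↭ p)
~C⇒↭ (~-trans p q) = ↭-trans (~C⇒↭ p) (~C⇒↭ q)
~C⇒↭ (~-swap u v s t _) = ++⁺ˡ u (swap s t ↭-refl)

~C-length : u ~C v → length u ≡ length v
~C-length p = ↭-length (~C⇒↭ p)

~C-occ : ∀ r → u ~C v → occ r u ≡ occ r v
~C-occ r p = ↭-length (filter-↭ (_≟ r) (~C⇒↭ p))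

~C⇒≈W : u ~C v → u ≈W v
~C⇒≈W ~-refl = ≈-refl
~C⇒≈W (~-sym p) = ≈-sym (~C⇒≈W p)
~C⇒≈W (~-trans p q) = ≈-trans (~C⇒≈W p) (~C⇒≈W q)
~C⇒≈W (~-swap u v s t mst≡2) =
  subst (λ k → (u ++ alt s t k ++ v) ≈W (u ++ alt t s k ++ v)) mst≡2 (≈-braid u v s t s≢t)
  where
  s≢t : s ≢ t
  s≢t refl with () ← trans (sym (m-diagonal s)) mst≡2

erase : Gen → Word → Word
erase g = filter (λ x → ¬? (x ≟ g))

erase-swap : ∀ g x v → erase g (g ∷ x ∷ v) ≡ erase g (x ∷ g ∷ v)
erase-swap g x v = by-cases (x ≟ g)
  where
  open ≡-Reasoning
  P? = λ y → ¬? (y ≟ g)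
  by-cases : Dec (x ≡ g) → erase g (g ∷ x ∷ v) ≡ erase g (x ∷ g ∷ v)
  by-cases (yes refl) = refl
  by-cases (no x≢g) = begin
    erase g (g ∷ x ∷ v)  ≡⟨ filter-reject P? (λ g≢g → g≢g refl) ⟩
    erase g (x ∷ v)      ≡⟨ filter-accept P? x≢g ⟩
    x ∷ erase g v        ≡⟨ cong (x ∷_) (filter-reject P? (λ g≢g → g≢g refl)) ⟨
    x ∷ erase g (g ∷ v)  ≡⟨ filter-accept P? x≢g ⟨
    erase g (x ∷ g ∷ v)  ∎

erase-~C : ∀ g → (∀ {s t} → m s t ≡ 2 → s ≡ g ⊎ t ≡ g) → u ~C v → erase g u ≡ erase g v
erase-~C g _ ~-refl = refl
erase-~C g meets (~-sym p) = sym (erase-~C g meets p)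
erase-~C g meets (~-trans p q) = trans (erase-~C g meets p) (erase-~C g meets q)
erase-~C g meets (~-swap u v s t mst≡2) = begin
  erase g (u ++ s ∷ t ∷ v)          ≡⟨ filter-++ P? u _ ⟩
  erase g u ++ erase g (s ∷ t ∷ v)  ≡⟨ cong (erase g u ++_) (swapped (meets mst≡2)) ⟩
  erase g u ++ erase g (t ∷ s ∷ v)  ≡⟨ filter-++ P? u _ ⟨
  erase g (u ++ t ∷ s ∷ v)          ∎
  where
  open ≡-Reasoning
  P? = λ y → ¬? (y ≟ g)
  swapped : s ≡ g ⊎ t ≡ g → erase g (s ∷ t ∷ v) ≡ erase g (t ∷ s ∷ v)
  swapped (inj₁ refl) = erase-swap g t v
  swapped (inj₂ refl) = sym (erase-swap g s v)

s₁-in-commuting-pair : m s t ≡ 2 → s ≡ s₁ ⊎ t ≡ s₁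
s₁-in-commuting-pair mst≡2 with commuting-pair mst≡2
... | inj₁ (s≡s₁ , _) = inj₁ s≡s₁
... | inj₂ (_ , t≡s₁) = inj₂ t≡s₁

s₃-in-commuting-pair : m s t ≡ 2 → s ≡ s₃ ⊎ t ≡ s₃
s₃-in-commuting-pair mst≡2 with commuting-pair mst≡2
... | inj₁ (_ , t≡s₃) = inj₂ t≡s₃
... | inj₂ (s≡s₃ , _) = inj₁ s≡s₃

erase-factor-~C : ∀ g → (∀ {s t} → m s t ≡ 2 → s ≡ g ⊎ t ≡ g) →
                  ∀ a b {x y} → (a ++ x ++ b) ~C (a ++ y ++ b) → erase g x ≡ erase g y
erase-factor-~C g meets a b {x} {y} p =
  ++-cancelʳ (erase g b) (erase g x) (erase g y)
    (++-cancelˡ (erase g a) _ _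
      (trans (sym (erase-infix x)) (trans (erase-~C g meets p) (erase-infix y))))
  where
  P? = λ z → ¬? (z ≟ g)
  erase-infix : ∀ z → erase g (a ++ z ++ b) ≡ erase g a ++ erase g z ++ erase g b
  erase-infix z = trans (filter-++ P? a _) (cong (erase g a ++_) (filter-++ P? z b))

data NonCommuting : Gen → Gen → Set where
  nc12 : NonCommuting s₁ s₂
  nc21 : NonCommuting s₂ s₁
  nc23 : NonCommuting s₂ s₃
  nc32 : NonCommuting s₃ s₂

nonCommuting⇒≢ : NonCommuting s t → s ≢ t
nonCommuting⇒≢ nc12 ()
nonCommuting⇒≢ nc21 ()
nonCommuting⇒≢ nc23 ()
nonCommuting⇒≢ nc32 ()

braid-not-~C : NonCommuting s t → ∀ a b →
               ¬ ((a ++ alt s t (m s t) ++ b) ~C (a ++ alt t s (m s t) ++ b))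
braid-not-~C nc12 a b p with () ← erase-factor-~C s₃ s₃-in-commuting-pair a b p
braid-not-~C nc21 a b p with () ← erase-factor-~C s₃ s₃-in-commuting-pair a b p
braid-not-~C nc23 a b p with () ← erase-factor-~C s₁ s₁-in-commuting-pair a b p
braid-not-~C nc32 a b p with () ← erase-factor-~C s₁ s₁-in-commuting-pair a b p

length-alt-swap : ∀ s t k → length (alt t s k) ≡ length (alt s t k)
length-alt-swap s t ℕ.zero = refl
length-alt-swap s t (ℕ.suc k) = cong ℕ.suc (length-alt-swap t s k)

length-++-infix : ∀ (a : Word) {x y} b → length x ≡ length y → length (a ++ x ++ b) ≡ length (a ++ y ++ b)
length-++-infix [] {x} {y} b |x|≡|y| = begin
  length (x ++ b)       ≡⟨ length-++ x ⟩
  length x + length b   ≡⟨ cong (_+ length b) |x|≡|y| ⟩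
  length y + length b   ≡⟨ length-++ y ⟨
  length (y ++ b)       ∎
  where open ≡-Reasoning
length-++-infix (_ ∷ a) b |x|≡|y| = cong ℕ.suc (length-++-infix a b |x|≡|y|)

reduced-≈W : ReducedExprFor x w → v ≈W x → length v ≡ length x → ReducedExprFor v w
reduced-≈W (x≈w , minimal) v≈x |v|≡|x| =
  ≈-trans v≈x x≈w , λ y y≈w → subst (_≤ length y) (sym |v|≡|x|) (minimal y y≈w)

reduced-~C : ReducedExprFor u w → u ~C x → ReducedExprFor x w
reduced-~C r u~x = reduced-≈W r (~C⇒≈W (~-sym u~x)) (sym (~C-length u~x))

reduced-no-square : ∀ a b g → ¬ ReducedExprFor (a ++ g ∷ g ∷ b) w
reduced-no-square a b g (x≈w , minimal) = <⇒≱ shorter (minimal (a ++ b) (≈-trans (≈-sym (≈-sq a b g)) x≈w))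
  where
  shorter : length (a ++ b) < length (a ++ g ∷ g ∷ b)
  shorter = subst₂ _<_ (sym (length-++ a)) (sym (length-++ a))
                   (+-monoʳ-< (length a) (m<n+m (length b) {2} z<s))

fc-reduced-no-braid : FullyCommutative w → NonCommuting s t →
                      ∀ a b → ¬ ReducedExprFor (a ++ alt s t (m s t) ++ b) w
fc-reduced-no-braid {w = w} {s = s} {t = t} fc nc a b r = braid-not-~C nc a b (fc _ _ r braided)
  where
  braided : ReducedExprFor (a ++ alt t s (m s t) ++ b) w
  braided = reduced-≈W r (≈-sym (≈-braid a b s t (nonCommuting⇒≢ nc)))
                         (length-++-infix a b (length-alt-swap s t (m s t)))

data Forbidden : Word → Set where
  square : ∀ a b g → Forbidden (a ++ g ∷ g ∷ b)
  braid  : ∀ a b → NonCommuting s t → Forbidden (a ++ alt s t (m s t) ++ b)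

ForbiddenUpToCommutation : Word → Set
ForbiddenUpToCommutation u = ∃[ x ] u ~C x × Forbidden x

fc-reduced-not-forbidden : FullyCommutative w → ReducedExprFor u w → ¬ ForbiddenUpToCommutation u
fc-reduced-not-forbidden fc r (_ , u~x , square a b g) = reduced-no-square a b g (reduced-~C r u~x)
fc-reduced-not-forbidden fc r (_ , u~x , braid a b nc) = fc-reduced-no-braid fc nc a b (reduced-~C r u~x)

forbidden-∷⁺ : ∀ g → ForbiddenUpToCommutation u → ForbiddenUpToCommutation (g ∷ u)
forbidden-∷⁺ g (_ , u~x , square a b h) = _ , ~C-∷⁺ g u~x , square (g ∷ a) b h
forbidden-∷⁺ g (_ , u~x , braid a b nc) = _ , ~C-∷⁺ g u~x , braid (g ∷ a) b nc

-- The commutation classes of reduced words of the 24 fully commutative elements of B₃.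
data FCClass : Set where
  q0 q1 q2 q3 q4 q5 q6 q7 q8 q9 q10 q11 q12 q13 q14 q15 q16 q17 q18 q19 q20 q21 q22 q23 : FCClass

word : FCClass → Word
word q0 = []
word q1 = s₁ ∷ []
word q2 = s₂ ∷ []
word q3 = s₃ ∷ []
word q4 = s₂ ∷ s₁ ∷ []
word q5 = s₁ ∷ s₃ ∷ []
word q6 = s₁ ∷ s₂ ∷ []
word q7 = s₃ ∷ s₂ ∷ []
word q8 = s₂ ∷ s₃ ∷ []
word q9 = s₁ ∷ s₂ ∷ s₁ ∷ []
word q10 = s₃ ∷ s₂ ∷ s₁ ∷ []
word q11 = s₂ ∷ s₁ ∷ s₃ ∷ []
word q12 = s₂ ∷ s₁ ∷ s₂ ∷ []
word q13 = s₁ ∷ s₃ ∷ s₂ ∷ []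
word q14 = s₁ ∷ s₂ ∷ s₃ ∷ []
word q15 = s₁ ∷ s₃ ∷ s₂ ∷ s₁ ∷ []
word q16 = s₁ ∷ s₂ ∷ s₁ ∷ s₃ ∷ []
word q17 = s₃ ∷ s₂ ∷ s₁ ∷ s₂ ∷ []
word q18 = s₂ ∷ s₁ ∷ s₃ ∷ s₂ ∷ []
word q19 = s₂ ∷ s₁ ∷ s₂ ∷ s₃ ∷ []
word q20 = s₂ ∷ s₁ ∷ s₃ ∷ s₂ ∷ s₁ ∷ []
word q21 = s₁ ∷ s₂ ∷ s₁ ∷ s₃ ∷ s₂ ∷ []
word q22 = s₃ ∷ s₂ ∷ s₁ ∷ s₂ ∷ s₃ ∷ []
word q23 = s₁ ∷ s₂ ∷ s₁ ∷ s₃ ∷ s₂ ∷ s₁ ∷ []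

extend : ∀ g c → ForbiddenUpToCommutation (g ∷ word c) ⊎ ∃[ c′ ] (g ∷ word c) ~C word c′
extend zero q0 = inj₂ (q1 , ~-refl)
extend (suc zero) q0 = inj₂ (q2 , ~-refl)
extend (suc (suc zero)) q0 = inj₂ (q3 , ~-refl)
extend zero q1 = inj₁ (_ , ~-refl , square [] [] s₁)
extend (suc zero) q1 = inj₂ (q4 , ~-refl)
extend (suc (suc zero)) q1 = inj₂ (q5 , ~-swap [] [] s₃ s₁ refl)
extend zero q2 = inj₂ (q6 , ~-refl)
extend (suc zero) q2 = inj₁ (_ , ~-refl , square [] [] s₂)
extend (suc (suc zero)) q2 = inj₂ (q7 , ~-refl)
extend zero q3 = inj₂ (q5 , ~-refl)
extend (suc zero) q3 = inj₂ (q8 , ~-refl)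
extend (suc (suc zero)) q3 = inj₁ (_ , ~-refl , square [] [] s₃)
extend zero q4 = inj₂ (q9 , ~-refl)
extend (suc zero) q4 = inj₁ (_ , ~-refl , square [] (s₁ ∷ []) s₂)
extend (suc (suc zero)) q4 = inj₂ (q10 , ~-refl)
extend zero q5 = inj₁ (_ , ~-refl , square [] (s₃ ∷ []) s₁)
extend (suc zero) q5 = inj₂ (q11 , ~-refl)
extend (suc (suc zero)) q5 = inj₁ (_ , ~-swap [] (s₃ ∷ []) s₃ s₁ refl , square (s₁ ∷ []) [] s₃)
extend zero q6 = inj₁ (_ , ~-refl , square [] (s₂ ∷ []) s₁)
extend (suc zero) q6 = inj₂ (q12 , ~-refl)
extend (suc (suc zero)) q6 = inj₂ (q13 , ~-swap [] (s₂ ∷ []) s₃ s₁ refl)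
extend zero q7 = inj₂ (q13 , ~-refl)
extend (suc zero) q7 = inj₁ (_ , ~-refl , braid [] [] nc23)
extend (suc (suc zero)) q7 = inj₁ (_ , ~-refl , square [] (s₂ ∷ []) s₃)
extend zero q8 = inj₂ (q14 , ~-refl)
extend (suc zero) q8 = inj₁ (_ , ~-refl , square [] (s₃ ∷ []) s₂)
extend (suc (suc zero)) q8 = inj₁ (_ , ~-refl , braid [] [] nc32)
extend zero q9 = inj₁ (_ , ~-refl , square [] (s₂ ∷ s₁ ∷ []) s₁)
extend (suc zero) q9 = inj₁ (_ , ~-refl , braid [] [] nc21)
extend (suc (suc zero)) q9 = inj₂ (q15 , ~-swap [] (s₂ ∷ s₁ ∷ []) s₃ s₁ refl)
extend zero q10 = inj₂ (q15 , ~-refl)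
extend (suc zero) q10 = inj₁ (_ , ~-refl , braid [] (s₁ ∷ []) nc23)
extend (suc (suc zero)) q10 = inj₁ (_ , ~-refl , square [] (s₂ ∷ s₁ ∷ []) s₃)
extend zero q11 = inj₂ (q16 , ~-refl)
extend (suc zero) q11 = inj₁ (_ , ~-refl , square [] (s₁ ∷ s₃ ∷ []) s₂)
extend (suc (suc zero)) q11 = inj₁ (_ , ~-swap (s₃ ∷ s₂ ∷ []) [] s₁ s₃ refl , braid [] (s₁ ∷ []) nc32)
extend zero q12 = inj₁ (_ , ~-refl , braid [] [] nc12)
extend (suc zero) q12 = inj₁ (_ , ~-refl , square [] (s₁ ∷ s₂ ∷ []) s₂)
extend (suc (suc zero)) q12 = inj₂ (q17 , ~-refl)
extend zero q13 = inj₁ (_ , ~-refl , square [] (s₃ ∷ s₂ ∷ []) s₁)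
extend (suc zero) q13 = inj₂ (q18 , ~-refl)
extend (suc (suc zero)) q13 = inj₁ (_ , ~-swap [] (s₃ ∷ s₂ ∷ []) s₃ s₁ refl , square (s₁ ∷ []) (s₂ ∷ []) s₃)
extend zero q14 = inj₁ (_ , ~-refl , square [] (s₂ ∷ s₃ ∷ []) s₁)
extend (suc zero) q14 = inj₂ (q19 , ~-refl)
extend (suc (suc zero)) q14 = inj₁ (_ , ~-swap [] (s₂ ∷ s₃ ∷ []) s₃ s₁ refl , braid (s₁ ∷ []) [] nc32)
extend zero q15 = inj₁ (_ , ~-refl , square [] (s₃ ∷ s₂ ∷ s₁ ∷ []) s₁)
extend (suc zero) q15 = inj₂ (q20 , ~-refl)
extend (suc (suc zero)) q15 = inj₁ (_ , ~-swap [] (s₃ ∷ s₂ ∷ s₁ ∷ []) s₃ s₁ refl , square (s₁ ∷ []) (s₂ ∷ s₁ ∷ []) s₃)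
extend zero q16 = inj₁ (_ , ~-refl , square [] (s₂ ∷ s₁ ∷ s₃ ∷ []) s₁)
extend (suc zero) q16 = inj₁ (_ , ~-refl , braid [] (s₃ ∷ []) nc21)
extend (suc (suc zero)) q16 = inj₁ (_ , ~-trans (~-swap [] (s₂ ∷ s₁ ∷ s₃ ∷ []) s₃ s₁ refl) (~-swap (s₁ ∷ s₃ ∷ s₂ ∷ []) [] s₁ s₃ refl) , braid (s₁ ∷ []) (s₁ ∷ []) nc32)
extend zero q17 = inj₁ (_ , ~-swap [] (s₂ ∷ s₁ ∷ s₂ ∷ []) s₁ s₃ refl , braid (s₃ ∷ []) [] nc12)
extend (suc zero) q17 = inj₁ (_ , ~-refl , braid [] (s₁ ∷ s₂ ∷ []) nc23)
extend (suc (suc zero)) q17 = inj₁ (_ , ~-refl , square [] (s₂ ∷ s₁ ∷ s₂ ∷ []) s₃)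
extend zero q18 = inj₂ (q21 , ~-refl)
extend (suc zero) q18 = inj₁ (_ , ~-refl , square [] (s₁ ∷ s₃ ∷ s₂ ∷ []) s₂)
extend (suc (suc zero)) q18 = inj₁ (_ , ~-swap (s₃ ∷ s₂ ∷ []) (s₂ ∷ []) s₁ s₃ refl , braid [] (s₁ ∷ s₂ ∷ []) nc32)
extend zero q19 = inj₁ (_ , ~-refl , braid [] (s₃ ∷ []) nc12)
extend (suc zero) q19 = inj₁ (_ , ~-refl , square [] (s₁ ∷ s₂ ∷ s₃ ∷ []) s₂)
extend (suc (suc zero)) q19 = inj₂ (q22 , ~-refl)
extend zero q20 = inj₂ (q23 , ~-refl)
extend (suc zero) q20 = inj₁ (_ , ~-refl , square [] (s₁ ∷ s₃ ∷ s₂ ∷ s₁ ∷ []) s₂)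
extend (suc (suc zero)) q20 = inj₁ (_ , ~-swap (s₃ ∷ s₂ ∷ []) (s₂ ∷ s₁ ∷ []) s₁ s₃ refl , braid [] (s₁ ∷ s₂ ∷ s₁ ∷ []) nc32)
extend zero q21 = inj₁ (_ , ~-refl , square [] (s₂ ∷ s₁ ∷ s₃ ∷ s₂ ∷ []) s₁)
extend (suc zero) q21 = inj₁ (_ , ~-refl , braid [] (s₃ ∷ s₂ ∷ []) nc21)
extend (suc (suc zero)) q21 = inj₁ (_ , ~-trans (~-swap [] (s₂ ∷ s₁ ∷ s₃ ∷ s₂ ∷ []) s₃ s₁ refl) (~-swap (s₁ ∷ s₃ ∷ s₂ ∷ []) (s₂ ∷ []) s₁ s₃ refl) , braid (s₁ ∷ []) (s₁ ∷ s₂ ∷ []) nc32)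
extend zero q22 = inj₁ (_ , ~-swap [] (s₂ ∷ s₁ ∷ s₂ ∷ s₃ ∷ []) s₁ s₃ refl , braid (s₃ ∷ []) (s₃ ∷ []) nc12)
extend (suc zero) q22 = inj₁ (_ , ~-refl , braid [] (s₁ ∷ s₂ ∷ s₃ ∷ []) nc23)
extend (suc (suc zero)) q22 = inj₁ (_ , ~-refl , square [] (s₂ ∷ s₁ ∷ s₂ ∷ s₃ ∷ []) s₃)
extend zero q23 = inj₁ (_ , ~-refl , square [] (s₂ ∷ s₁ ∷ s₃ ∷ s₂ ∷ s₁ ∷ []) s₁)
extend (suc zero) q23 = inj₁ (_ , ~-refl , braid [] (s₃ ∷ s₂ ∷ s₁ ∷ []) nc21)
extend (suc (suc zero)) q23 = inj₁ (_ , ~-trans (~-swap [] (s₂ ∷ s₁ ∷ s₃ ∷ s₂ ∷ s₁ ∷ []) s₃ s₁ refl) (~-swap (s₁ ∷ s₃ ∷ s₂ ∷ []) (s₂ ∷ s₁ ∷ []) s₁ s₃ refl) , braid (s₁ ∷ []) (s₁ ∷ s₂ ∷ s₁ ∷ []) nc32)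

classify : ∀ u → ForbiddenUpToCommutation u ⊎ ∃[ c ] u ~C word c
classify [] = inj₂ (q0 , ~-refl)
classify (g ∷ u) with classify u
... | inj₁ forbidden = inj₁ (forbidden-∷⁺ g forbidden)
... | inj₂ (c , u~c) with extend g c
...   | inj₁ (x , gc~x , f) = inj₁ (x , ~-trans (~C-∷⁺ g u~c) gc~x , f)
...   | inj₂ (c′ , gc~c′) = inj₂ (c′ , ~-trans (~C-∷⁺ g u~c) gc~c′)

≤-by-decision : ∀ {m n} {m≤?n : True (m ≤? n)} → m ≤ n
≤-by-decision {m≤?n = m≤?n} = toWitness m≤?n

word-bounds : ∀ c → (occ s₂ (word c) ≤ 3) × (occ s₃ (word c) ≤ 3)
word-bounds q0 = ≤-by-decision , ≤-by-decision
word-bounds q1 = ≤-by-decision , ≤-by-decision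
word-bounds q2 = ≤-by-decision , ≤-by-decision
word-bounds q3 = ≤-by-decision , ≤-by-decision
word-bounds q4 = ≤-by-decision , ≤-by-decision
word-bounds q5 = ≤-by-decision , ≤-by-decision
word-bounds q6 = ≤-by-decision , ≤-by-decision
word-bounds q7 = ≤-by-decision , ≤-by-decision
word-bounds q8 = ≤-by-decision , ≤-by-decision
word-bounds q9 = ≤-by-decision , ≤-by-decision
word-bounds q10 = ≤-by-decision , ≤-by-decision
word-bounds q11 = ≤-by-decision , ≤-by-decision
word-bounds q12 = ≤-by-decision , ≤-by-decision
word-bounds q13 = ≤-by-decision , ≤-by-decision
word-bounds q14 = ≤-by-decision , ≤-by-decision
word-bounds q15 = ≤-by-decision , ≤-by-decision
word-bounds q16 = ≤-by-decision , ≤-by-decision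
word-bounds q17 = ≤-by-decision , ≤-by-decision
word-bounds q18 = ≤-by-decision , ≤-by-decision
word-bounds q19 = ≤-by-decision , ≤-by-decision
word-bounds q20 = ≤-by-decision , ≤-by-decision
word-bounds q21 = ≤-by-decision , ≤-by-decision
word-bounds q22 = ≤-by-decision , ≤-by-decision
word-bounds q23 = ≤-by-decision , ≤-by-decision

lemma4p3p1 : ∀ (w : Word) → FullyCommutative w →
    ∀ (u : Word) → ReducedExprFor u w → (occ s₂ u ≤ 3) × (occ s₃ u ≤ 3)
lemma4p3p1 w fc u r with classify u
... | inj₁ forbidden = ⊥-elim (fc-reduced-not-forbidden fc r forbidden)
... | inj₂ (c , u~c) =
  subst (_≤ 3) (sym (~C-occ s₂ u~c)) (proj₁ (word-bounds c)) ,
  subst (_≤ 3) (sym (~C-occ s₃ u~c)) (proj₂ (word-bounds c))
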